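{- Let $G$ be a graph with PSD forcing set $B$. Let $C$ be a connected component of $G-B$, and let $H=G[V(C)\cup B]$. Fix the PSD forces performed in $H$ at the first time step (starting with exactly $B$ blue in $H$), choosing for each vertex forced one vertex of $B$ that forces it, say $b_1\to v_1,\dots,b_j\to v_j$ with $b_1,\dots,b_j$ distinct, and let $B'=(B\setminus\{b_1,\dots,b_j\})\cup\{v_1,\dots,v_j\}$ (the endpoints in $H$ of the PSD forcing trees after the first time step). Then $B'$ is a PSD forcing set of $G$ with $|B'|=|B|$.
   Context: Graphs are finite and simple; $G[U]$ denotes the subgraph induced by $U$. PSD color change rule: let $B$ be the current set of blue vertices and let $W_1,\dots,W_r$ be the vertex sets of the components of $G-B$; if $u\in B$, $w\in W_i$, and $w$ is the only white neighbor of $u$ in $G[W_i\cup B]$, then $u$ may force $w$, i.e., color it blue. A set $B$ is a PSD forcing set if starting with exactly $B$ blue, repeated application of the rule colors all vertices blue. Forces at the first time step are those valid when exactly the initial set is blue. -}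

module Defs where

open import Data.Nat using (ℕ)
open import Data.Bool using (Bool; true; false)
open import Data.Fin using (Fin)
open import Data.Fin.Subset using (Subset; _∈_; _∉_; _∪_; _-_; ⁅_⁆)
open import Data.List using (List; foldr; map)
open import Data.Product using (_×_; _,_; proj₁; proj₂)
open import Data.Sum using (_⊎_)
open import Data.Unit using (⊤)
open import Relation.Binary.PropositionalEquality using (_≡_)

record Graph (n : ℕ) : Set where
  field
    adj    : Fin n → Fin n → Bool
    sym    : ∀ x y → adj x y ≡ adj y x
    irrefl : ∀ x → adj x x ≡ false

open Graph public

module _ {n : ℕ} (G : Graph n) where

  Adj : Fin n → Fin n → Set
  Adj x y = adj G x y ≡ true

  -- Induced subgraph G[U] is represented by its vertex predicate U.
  -- WhiteConn U B x y : x and y lie in the same component of G[U] - B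
  -- (there is a path x → y through vertices in U \ B).
  data WhiteConn (U : Fin n → Set) (B : Subset n) (x : Fin n) : Fin n → Set where
    here : U x → x ∉ B → WhiteConn U B x x
    step : ∀ {y z} → WhiteConn U B x y → U z → z ∉ B → Adj y z → WhiteConn U B x z

  -- PSD color change rule in G[U] with current blue set B:
  -- u ∈ B forces w, where w is white, adjacent to u, and the only white
  -- neighbour of u in G[W ∪ B], W the component of G[U] - B containing w.
  ForceIn : (U : Fin n → Set) → Subset n → Fin n → Fin n → Set
  ForceIn U B u w =
    U u × u ∈ B × U w × w ∉ B × Adj u w ×
    (∀ w' → WhiteConn U B w w' → Adj u w' → w' ≡ w)

  AllV : Fin n → Set
  AllV _ = ⊤

  Force : Subset n → Fin n → Fin n → Set
  Force = ForceIn AllV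

  data Completes : Subset n → Set where
    done : ∀ {S} → (∀ x → x ∈ S) → Completes S
    next : ∀ {S u w} → Force S u w → Completes (S ∪ ⁅ w ⁆) → Completes S

  IsPSDForcingSet : Subset n → Set
  IsPSDForcingSet B = Completes B

  -- Vertex set V(C) ∪ B of H = G[V(C) ∪ B], where C is the component of
  -- G - B containing c.
  CompPlusB : Subset n → Fin n → Fin n → Set
  CompPlusB B c x = WhiteConn AllV B c x ⊎ x ∈ B

removeAll : ∀ {n} → List (Fin n) → Subset n → Subset n
removeAll bs S = foldr (λ b T → T - b) S bs

addAll : ∀ {n} → List (Fin n) → Subset n → Subset n
addAll vs S = foldr (λ v T → T ∪ ⁅ v ⁆) S vs

swapForces : ∀ {n} → List (Fin n × Fin n) → Subset n → Subset n
swapForces fs B = addAll (map proj₂ fs) (removeAll (map proj₁ fs) B)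

{-# OPTIONS --safe #-}
module Submission where

-- Write b → v for the chosen first-step forces and C for the component of G − B.
-- Since b forces v inside H, v is the only neighbour of b in C. Starting from B′,
-- every v can force its b back. Indeed, for any blue set S ⊇ B′ the white component
-- of G − S containing b never meets C: entering C from a white vertex of B means
-- passing from some b′ to its unique C-neighbour v′, which is blue. So a neighbour of
-- v in that component lies in B, hence is some white b′ adjacent to v ∈ C, and then
-- v′ = v and b′ = b. After all forces are reversed every vertex of B is blue, and a
-- superset of a PSD forcing set is one. For the cardinality: the b are distinct
-- vertices of B and the v distinct vertices outside B.

open import Defs hiding (sym)
open import Data.Nat using (ℕ; suc; _+_)
open import Data.Nat.Properties using (+-suc; +-identityʳ)
open import Data.Fin using (Fin; zero; suc; _≟_)
open import Data.Fin.Subset using (Subset; _∈_; _∉_; _⊆_; _∪_; _-_; ⁅_⁆; ∣_∣; inside; outside)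
open import Data.Fin.Subset.Properties
  using (_∈?_; ⊆-refl; ⊆-trans; p⊆p∪q; x∈p∪q⁺; x∈p∪q⁻; x∈⁅x⁆; x∈⁅y⁆⇒x≡y; p─q⊆p; p─⊥≡p;
         x∈p∧x≢y⇒x∈p-y; ∪-identityʳ)
open import Data.Vec.Base using (_∷_; here; there)
open import Data.List using (List; []; _∷_; map; length)
open import Data.List.Properties using (length-map)
open import Data.List.Relation.Unary.All as All using (All; []; _∷_)
open import Data.List.Relation.Unary.All.Properties using (All¬⇒¬Any; map⁺)
open import Data.List.Relation.Unary.Any using (here; there)
open import Data.List.Relation.Unary.AllPairs using (_∷_)
open import Data.List.Relation.Unary.Unique.Propositional using (Unique)
open import Data.List.Membership.Propositional using () renaming (_∈_ to _∈ˡ_; _∉_ to _∉ˡ_)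
open import Data.List.Membership.Propositional.Properties using (∈-map⁺; ∈-map⁻)
import Data.List.Membership.DecPropositional as DecMembership
open import Data.Product using (_×_; _,_; proj₁; proj₂; ∃)
open import Data.Sum using (_⊎_; inj₁; inj₂; [_,_]′)
open import Data.Unit using (tt)
open import Data.Empty using (⊥-elim)
open import Function using (_∘_; id)
open import Relation.Nullary using (yes; no)
open import Relation.Binary.PropositionalEquality using (_≡_; refl; sym; trans; cong; subst; module ≡-Reasoning)

Unique-map⇒injectiveOn : ∀ {A B : Set} (f : A → B) {xs : List A} → Unique (map f xs) →
  ∀ {x y} → x ∈ˡ xs → y ∈ˡ xs → f x ≡ f y → x ≡ y
Unique-map⇒injectiveOn f (_ ∷ _)      (here refl) (here refl) _     = refl
Unique-map⇒injectiveOn f (x≢ ∷ _)     (here refl) (there y∈)  fx≡fy = ⊥-elim (All.lookup x≢ (∈-map⁺ f y∈) fx≡fy)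
Unique-map⇒injectiveOn f (y≢ ∷ _)     (there x∈)  (here refl) fx≡fy = ⊥-elim (All.lookup y≢ (∈-map⁺ f x∈) (sym fx≡fy))
Unique-map⇒injectiveOn f (_ ∷ unique) (there x∈)  (there y∈)  fx≡fy = Unique-map⇒injectiveOn f unique x∈ y∈ fx≡fy

module _ {n : ℕ} where

  ∪⁅⁆⊆ : ∀ {p q : Subset n} {x} → p ⊆ q → x ∈ q → p ∪ ⁅ x ⁆ ⊆ q
  ∪⁅⁆⊆ {p} {q} {x} p⊆q x∈q y∈ = [ p⊆q , (λ y∈⁅x⁆ → subst (_∈ q) (sym (x∈⁅y⁆⇒x≡y x y∈⁅x⁆)) x∈q) ]′ (x∈p∪q⁻ p ⁅ x ⁆ y∈)

  ∪⁅⁆-monoˡ : ∀ {p q : Subset n} {x} → p ⊆ q → p ∪ ⁅ x ⁆ ⊆ q ∪ ⁅ x ⁆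
  ∪⁅⁆-monoˡ {x = x} p⊆q = ∪⁅⁆⊆ (p⊆p∪q ⁅ x ⁆ ∘ p⊆q) (x∈p∪q⁺ (inj₂ (x∈⁅x⁆ x)))

x∈p⇒suc∣p-x∣≡∣p∣ : ∀ {n} (p : Subset n) {x} → x ∈ p → suc ∣ p - x ∣ ≡ ∣ p ∣
x∈p⇒suc∣p-x∣≡∣p∣ (inside ∷ p)  here        = cong (suc ∘ ∣_∣) (p─⊥≡p p)
x∈p⇒suc∣p-x∣≡∣p∣ (inside ∷ p)  (there x∈p) = cong suc (x∈p⇒suc∣p-x∣≡∣p∣ p x∈p)
x∈p⇒suc∣p-x∣≡∣p∣ (outside ∷ p) (there x∈p) = x∈p⇒suc∣p-x∣≡∣p∣ p x∈p

x∉p⇒∣p∪⁅x⁆∣≡suc∣p∣ : ∀ {n} (p : Subset n) {x} → x ∉ p → ∣ p ∪ ⁅ x ⁆ ∣ ≡ suc ∣ p ∣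
x∉p⇒∣p∪⁅x⁆∣≡suc∣p∣ (inside ∷ p)  {zero}  x∉p = ⊥-elim (x∉p here)
x∉p⇒∣p∪⁅x⁆∣≡suc∣p∣ (outside ∷ p) {zero}  x∉p = cong (suc ∘ ∣_∣) (∪-identityʳ p)
x∉p⇒∣p∪⁅x⁆∣≡suc∣p∣ (inside ∷ p)  {suc x} x∉p = cong suc (x∉p⇒∣p∪⁅x⁆∣≡suc∣p∣ p (x∉p ∘ there))
x∉p⇒∣p∪⁅x⁆∣≡suc∣p∣ (outside ∷ p) {suc x} x∉p = x∉p⇒∣p∪⁅x⁆∣≡suc∣p∣ p (x∉p ∘ there)

module _ {n : ℕ} where

  open DecMembership (_≟_ {n}) using () renaming (_∈?_ to _∈ˡ?_)

  removeAll⊆ : ∀ (xs : List (Fin n)) (p : Subset n) → removeAll xs p ⊆ p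
  removeAll⊆ []       p y∈ = y∈
  removeAll⊆ (x ∷ xs) p y∈ = removeAll⊆ xs p (p─q⊆p _ _ y∈)

  ∈-removeAll⁺ : ∀ (xs : List (Fin n)) {p : Subset n} {y} → y ∈ p → y ∉ˡ xs → y ∈ removeAll xs p
  ∈-removeAll⁺ []       y∈p _    = y∈p
  ∈-removeAll⁺ (x ∷ xs) y∈p y∉xs =
    x∈p∧x≢y⇒x∈p-y (∈-removeAll⁺ xs y∈p (y∉xs ∘ there)) (y∉xs ∘ here)

  ∈⇒∈-removeAll⊎∈ˡ : ∀ (xs : List (Fin n)) {p : Subset n} {y} → y ∈ p → y ∈ removeAll xs p ⊎ y ∈ˡ xs
  ∈⇒∈-removeAll⊎∈ˡ xs {y = y} y∈p with y ∈ˡ? xs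
  ... | yes y∈xs = inj₂ y∈xs
  ... | no  y∉xs = inj₁ (∈-removeAll⁺ xs y∈p y∉xs)

  ∈-addAll⁺ˡ : ∀ (xs : List (Fin n)) {p : Subset n} → p ⊆ addAll xs p
  ∈-addAll⁺ˡ []       y∈p = y∈p
  ∈-addAll⁺ˡ (x ∷ xs) y∈p = x∈p∪q⁺ (inj₁ (∈-addAll⁺ˡ xs y∈p))

  ∈-addAll⁺ʳ : ∀ (xs : List (Fin n)) {p : Subset n} {y} → y ∈ˡ xs → y ∈ addAll xs p
  ∈-addAll⁺ʳ (x ∷ xs) (here refl) = x∈p∪q⁺ (inj₂ (x∈⁅x⁆ x))
  ∈-addAll⁺ʳ (x ∷ xs) (there y∈)  = x∈p∪q⁺ (inj₁ (∈-addAll⁺ʳ xs y∈))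

  ∈-addAll⁻ : ∀ (xs : List (Fin n)) {p : Subset n} {y} → y ∈ addAll xs p → y ∈ p ⊎ y ∈ˡ xs
  ∈-addAll⁻ []       y∈ = inj₁ y∈
  ∈-addAll⁻ (x ∷ xs) {p} y∈ with x∈p∪q⁻ (addAll xs p) ⁅ x ⁆ y∈
  ... | inj₂ y∈⁅x⁆ = inj₂ (here (x∈⁅y⁆⇒x≡y x y∈⁅x⁆))
  ... | inj₁ y∈′ with ∈-addAll⁻ xs y∈′
  ...   | inj₁ y∈p  = inj₁ y∈p
  ...   | inj₂ y∈xs = inj₂ (there y∈xs)

  ∣removeAll∣+length≡∣p∣ : ∀ (xs : List (Fin n)) (p : Subset n) → Unique xs → All (_∈ p) xs →
    ∣ removeAll xs p ∣ + length xs ≡ ∣ p ∣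
  ∣removeAll∣+length≡∣p∣ []       p _              _             = +-identityʳ ∣ p ∣
  ∣removeAll∣+length≡∣p∣ (x ∷ xs) p (x≢ ∷ unique) (x∈p ∷ xs⊆p) = begin
    ∣ removeAll xs p - x ∣ + suc (length xs)  ≡⟨ +-suc _ (length xs) ⟩
    suc ∣ removeAll xs p - x ∣ + length xs    ≡⟨ cong (_+ length xs) (x∈p⇒suc∣p-x∣≡∣p∣ _ x∈removeAll) ⟩
    ∣ removeAll xs p ∣ + length xs            ≡⟨ ∣removeAll∣+length≡∣p∣ xs p unique xs⊆p ⟩
    ∣ p ∣                                     ∎
    where
    open ≡-Reasoning
    x∈removeAll : x ∈ removeAll xs p
    x∈removeAll = ∈-removeAll⁺ xs x∈p (All¬⇒¬Any x≢)

  ∣addAll∣≡∣p∣+length : ∀ (xs : List (Fin n)) (p : Subset n) → Unique xs → All (_∉ p) xs →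
    ∣ addAll xs p ∣ ≡ ∣ p ∣ + length xs
  ∣addAll∣≡∣p∣+length []       p _              _             = sym (+-identityʳ ∣ p ∣)
  ∣addAll∣≡∣p∣+length (x ∷ xs) p (x≢ ∷ unique) (x∉p ∷ xs∉p) = begin
    ∣ addAll xs p ∪ ⁅ x ⁆ ∣   ≡⟨ x∉p⇒∣p∪⁅x⁆∣≡suc∣p∣ _ x∉addAll ⟩
    suc ∣ addAll xs p ∣       ≡⟨ cong suc (∣addAll∣≡∣p∣+length xs p unique xs∉p) ⟩
    suc (∣ p ∣ + length xs)   ≡⟨ +-suc ∣ p ∣ (length xs) ⟨
    ∣ p ∣ + suc (length xs)   ∎
    where
    open ≡-Reasoning
    x∉addAll : x ∉ addAll xs p
    x∉addAll x∈ = [ x∉p , All¬⇒¬Any x≢ ]′ (∈-addAll⁻ xs x∈)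

  ∣swapForces∣≡∣p∣ : ∀ (fs : List (Fin n × Fin n)) (p : Subset n) →
    All (λ f → proj₁ f ∈ p × proj₂ f ∉ p) fs →
    Unique (map proj₁ fs) → Unique (map proj₂ fs) → ∣ swapForces fs p ∣ ≡ ∣ p ∣
  ∣swapForces∣≡∣p∣ fs p swapsOut unique₁ unique₂ = begin
    ∣ addAll (map proj₂ fs) R ∣   ≡⟨ ∣addAll∣≡∣p∣+length (map proj₂ fs) R unique₂ targets∉R ⟩
    ∣ R ∣ + length (map proj₂ fs) ≡⟨ cong (∣ R ∣ +_) (trans (length-map proj₂ fs) (sym (length-map proj₁ fs))) ⟩
    ∣ R ∣ + length (map proj₁ fs) ≡⟨ ∣removeAll∣+length≡∣p∣ (map proj₁ fs) p unique₁ (map⁺ (All.map proj₁ swapsOut)) ⟩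
    ∣ p ∣                         ∎
    where
    open ≡-Reasoning
    R : Subset n
    R = removeAll (map proj₁ fs) p
    targets∉R : All (_∉ R) (map proj₂ fs)
    targets∉R = map⁺ (All.map (λ swap → proj₂ swap ∘ removeAll⊆ (map proj₁ fs) p) swapsOut)

module _ {n : ℕ} (G : Graph n) where

  Adj-sym : ∀ {x y} → Adj G x y → Adj G y x
  Adj-sym {x} {y} x~y = trans (Graph.sym G y x) x~y

  module _ {U : Fin n → Set} where

    WhiteConn-end : ∀ {S x y} → WhiteConn G U S x y → U y × y ∉ S
    WhiteConn-end (here Ux x∉S)     = Ux , x∉S
    WhiteConn-end (step _ Uz z∉S _) = Uz , z∉S

    WhiteConn-trans : ∀ {S x y z} → WhiteConn G U S x y → WhiteConn G U S y z → WhiteConn G U S x z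
    WhiteConn-trans x⇝y (here _ _)             = x⇝y
    WhiteConn-trans x⇝y (step y⇝z Uw w∉S z~w) = step (WhiteConn-trans x⇝y y⇝z) Uw w∉S z~w

    WhiteConn-sym : ∀ {S x y} → WhiteConn G U S x y → WhiteConn G U S y x
    WhiteConn-sym (here Ux x∉S) = here Ux x∉S
    WhiteConn-sym (step x⇝y Uz z∉S y~z) with WhiteConn-end x⇝y
    ... | Uy , y∉S = WhiteConn-trans (step (here Uz z∉S) Uy y∉S (Adj-sym y~z)) (WhiteConn-sym x⇝y)

    WhiteConn-antimono : ∀ {S T x y} → S ⊆ T → WhiteConn G U T x y → WhiteConn G U S x y
    WhiteConn-antimono S⊆T (here Ux x∉T)         = here Ux (x∉T ∘ S⊆T)
    WhiteConn-antimono S⊆T (step x⇝y Uz z∉T y~z) = step (WhiteConn-antimono S⊆T x⇝y) Uz (z∉T ∘ S⊆T) y~z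

  Force-mono : ∀ {S T u w} → S ⊆ T → w ∉ T → Force G S u w → Force G T u w
  Force-mono S⊆T w∉T (_ , u∈S , _ , _ , u~w , only) =
    tt , S⊆T u∈S , tt , w∉T , u~w , λ w′ w⇝w′ → only w′ (WhiteConn-antimono S⊆T w⇝w′)

  Completes-mono : ∀ {S T} → S ⊆ T → Completes G S → Completes G T
  Completes-mono S⊆T (done all) = done (S⊆T ∘ all)
  Completes-mono {T = T} S⊆T (next {w = w} u→w rest) with w ∈? T
  ... | yes w∈T = Completes-mono (∪⁅⁆⊆ S⊆T w∈T) rest
  ... | no  w∉T = next (Force-mono S⊆T w∉T u→w) (Completes-mono (∪⁅⁆-monoˡ S⊆T) rest)

  record SoleNeighbourIn (C : Fin n → Set) (b v : Fin n) : Set where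
    field
      inC      : C v
      adjacent : Adj G b v
      unique   : ∀ {z} → C z → Adj G b z → z ≡ v

  open SoleNeighbourIn

  -- C is any union of components of G − B.
  module ReverseForces (B : Subset n) (C : Fin n → Set)
    (C∩B≡∅ : ∀ {x} → C x → x ∉ B)
    (C-closed : ∀ {y z} → C y → Adj G y z → z ∉ B → C z)
    (fs : List (Fin n × Fin n))
    (fs-sole : All (λ f → proj₁ f ∈ B × SoleNeighbourIn C (proj₁ f) (proj₂ f)) fs)
    (unique₂ : Unique (map proj₂ fs)) where

    B′ : Subset n
    B′ = swapForces fs B

    private
      sole : ∀ {f} → f ∈ˡ fs → SoleNeighbourIn C (proj₁ f) (proj₂ f)
      sole = proj₂ ∘ All.lookup fs-sole

    target∈B′ : ∀ {f} → f ∈ˡ fs → proj₂ f ∈ B′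
    target∈B′ f∈fs = ∈-addAll⁺ʳ (map proj₂ fs) (∈-map⁺ proj₂ f∈fs)

    B-B′⊆sources : ∀ {y} → y ∈ B → y ∉ B′ → ∃ λ f → f ∈ˡ fs × y ≡ proj₁ f
    B-B′⊆sources y∈B y∉B′ with ∈⇒∈-removeAll⊎∈ˡ (map proj₁ fs) y∈B
    ... | inj₁ y∈R  = ⊥-elim (y∉B′ (∈-addAll⁺ˡ (map proj₂ fs) y∈R))
    ... | inj₂ y∈bs = ∈-map⁻ proj₁ y∈bs

    C-neighbour-of-B-B′ : ∀ {y z} → y ∈ B → y ∉ B′ → C z → Adj G y z →
      ∃ λ f → f ∈ˡ fs × y ≡ proj₁ f × z ≡ proj₂ f
    C-neighbour-of-B-B′ y∈B y∉B′ Cz y~z with B-B′⊆sources y∈B y∉B′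
    ... | f , f∈fs , refl = f , f∈fs , refl , unique (sole f∈fs) Cz y~z

    C-closed-outside : ∀ {S y z} → B′ ⊆ S → C z → z ∉ S → y ∉ S → Adj G y z → C y
    C-closed-outside {y = y} B′⊆S Cz z∉S y∉S y~z with y ∈? B
    ... | no  y∉B = C-closed Cz (Adj-sym y~z) y∉B
    ... | yes y∈B with C-neighbour-of-B-B′ y∈B (y∉S ∘ B′⊆S) Cz y~z
    ...   | f , f∈fs , _ , z≡v = ⊥-elim (z∉S (B′⊆S (subst (_∈ B′) (sym z≡v) (target∈B′ f∈fs))))

    WhiteConn-into-C : ∀ {S x w} → B′ ⊆ S → WhiteConn G (AllV G) S x w → C w → C x
    WhiteConn-into-C B′⊆S (here _ _)             Cx = Cx
    WhiteConn-into-C B′⊆S (step x⇝y _ z∉S y~z) Cz =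
      WhiteConn-into-C B′⊆S x⇝y (C-closed-outside B′⊆S Cz z∉S (proj₂ (WhiteConn-end x⇝y)) y~z)

    reverse-force : ∀ {S f} → B′ ⊆ S → f ∈ˡ fs → proj₁ f ∉ S → Force G S (proj₂ f) (proj₁ f)
    reverse-force {S} {b , v} B′⊆S f∈fs b∉S =
      tt , B′⊆S (target∈B′ f∈fs) , tt , b∉S , Adj-sym (adjacent (sole f∈fs)) , only-b
      where
      only-b : ∀ w → WhiteConn G (AllV G) S b w → Adj G v w → w ≡ b
      only-b w b⇝w v~w with w ∈? B
      ... | no  w∉B = ⊥-elim (C∩B≡∅ Cb (proj₁ (All.lookup fs-sole f∈fs)))
        where
        Cb : C b
        Cb = WhiteConn-into-C B′⊆S b⇝w (C-closed (inC (sole f∈fs)) v~w w∉B)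
      ... | yes w∈B with C-neighbour-of-B-B′ w∈B (proj₂ (WhiteConn-end b⇝w) ∘ B′⊆S)
                           (inC (sole f∈fs)) (Adj-sym v~w)
      ...   | g , g∈fs , w≡b′ , v≡v′ =
        trans w≡b′ (cong proj₁ (sym (Unique-map⇒injectiveOn proj₂ unique₂ f∈fs g∈fs v≡v′)))

    Completes-∪source : ∀ {S f} → B′ ⊆ S → f ∈ˡ fs → Completes G (S ∪ ⁅ proj₁ f ⁆) → Completes G S
    Completes-∪source {S} {f} B′⊆S f∈fs rest with proj₁ f ∈? S
    ... | yes b∈S = Completes-mono (∪⁅⁆⊆ ⊆-refl b∈S) rest
    ... | no  b∉S = next (reverse-force B′⊆S f∈fs b∉S) rest

    Completes-addSources : ∀ {S} gs → All (_∈ˡ fs) gs → B′ ⊆ S →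
      Completes G (addAll (map proj₁ gs) S) → Completes G S
    Completes-addSources []       []               _    rest = rest
    Completes-addSources (g ∷ gs) (g∈fs ∷ gs⊆fs) B′⊆S rest =
      Completes-addSources gs gs⊆fs B′⊆S
        (Completes-∪source (⊆-trans B′⊆S (∈-addAll⁺ˡ (map proj₁ gs))) g∈fs rest)

    B′-completes : Completes G B → Completes G B′
    B′-completes B-completes =
      Completes-addSources fs (All.tabulate id) ⊆-refl (Completes-mono B⊆ B-completes)
      where
      B⊆ : B ⊆ addAll (map proj₁ fs) B′
      B⊆ x∈B with ∈⇒∈-removeAll⊎∈ˡ (map proj₁ fs) x∈B
      ... | inj₁ x∈R  = ∈-addAll⁺ˡ (map proj₁ fs) (∈-addAll⁺ˡ (map proj₂ fs) x∈R)
      ... | inj₂ x∈bs = ∈-addAll⁺ʳ (map proj₁ fs) x∈bs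

  module _ (B : Subset n) (c : Fin n) where

    WhiteConn-restrict : ∀ {y} → WhiteConn G (AllV G) B c y → WhiteConn G (CompPlusB G B c) B c y
    WhiteConn-restrict (here _ c∉B)           = here (inj₁ (here tt c∉B)) c∉B
    WhiteConn-restrict (step c⇝y _ z∉B y~z) = step (WhiteConn-restrict c⇝y) (inj₁ (step c⇝y tt z∉B y~z)) z∉B y~z

    firstForce⇒soleNeighbour : ∀ {b v} → ForceIn G (CompPlusB G B c) B b v →
      b ∈ B × SoleNeighbourIn (WhiteConn G (AllV G) B c) b v
    firstForce⇒soleNeighbour (_ , _ , inj₂ v∈B , v∉B , _) = ⊥-elim (v∉B v∈B)
    firstForce⇒soleNeighbour (_ , b∈B , inj₁ c⇝v , _ , b~v , only) = b∈B , record
      { inC      = c⇝v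
      ; adjacent = b~v
      ; unique   = λ c⇝z b~z →
          only _ (WhiteConn-trans (WhiteConn-sym (WhiteConn-restrict c⇝v)) (WhiteConn-restrict c⇝z)) b~z
      }

lemma3p3 : ∀ {n} (G : Graph n) (B : Subset n) → IsPSDForcingSet G B →
    (c : Fin n) → c ∉ B →
    (fs : List (Fin n × Fin n)) →
    All (λ p → ForceIn G (CompPlusB G B c) B (proj₁ p) (proj₂ p)) fs →
    (∀ u w → ForceIn G (CompPlusB G B c) B u w → w ∈ˡ map proj₂ fs) →
    Unique (map proj₂ fs) →
    Unique (map proj₁ fs) →
    IsPSDForcingSet G (swapForces fs B) × ∣ swapForces fs B ∣ ≡ ∣ B ∣
lemma3p3 G B B-forcing c _ fs forces _ unique₂ unique₁ =
  ReverseForces.B′-completes G B (WhiteConn G (AllV G) B c)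
    (proj₂ ∘ WhiteConn-end G) (λ c⇝y y~z z∉B → step c⇝y tt z∉B y~z)
    fs (All.map (firstForce⇒soleNeighbour G B c) forces) unique₂ B-forcing
  , ∣swapForces∣≡∣p∣ fs B (All.map (λ (_ , b∈B , _ , v∉B , _) → b∈B , v∉B) forces) unique₁ unique₂
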